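{- Let $t\geqslant 3$ be an integer. Let $\chi$ be a proper edge-coloring of $G=K_n$, let $X_1,X_2,X_3,X_4$ be a partition of $V(G)$, and let $\mathcal{G}$ be the auxiliary graph defined below. Let $\mathcal{G}_0$ be a subgraph of $\mathcal{G}$ which is bipartite with parts $A$ and $B$ (where $A$ is contained in one side of $\mathcal{G}$ and $B$ in the other), with $|B|=m$ and with every vertex of $A$ having degree at least $\delta$ in $\mathcal{G}_0$. Suppose $\mathcal{G}_0$ does not contain a copy of $H_t$ in which the vertices are pairwise disjoint. Then for any subset $U\subseteq A$ with $|U|\geqslant \frac{8tm}{\delta}$ and $|U|\geqslant 2$, the number of light pairs $\{u,v\}\subseteq U$ is at least $\frac{\delta^{2}}{16t^{3}m}\binom{|U|}{2}$.
   Context: $\mathcal{G}$ is the bipartite graph with vertex set $(X_1\times X_2)\cup(X_3\times X_4)$, in which $(x_1,x_2)\in X_1\times X_2$ is adjacent to $(x_3,x_4)\in X_3\times X_4$ if and only if the edges $x_1x_3$ and $x_2x_4$ of $G$ have the same color under $\chi$. Each vertex $(a,b)$ of $\mathcal{G}$ is regarded as the set $\{a,b\}\subseteq V(G)$. $H_t$ is the $1$-subdivision of $K_t$ (each edge of $K_t$ replaced by a path of length $2$). A copy of $H_t$ in $\mathcal{G}_0$ "in which the vertices are pairwise disjoint" means a subgraph of $\mathcal{G}_0$ isomorphic to $H_t$ whose vertices, regarded as $2$-element subsets of $V(G)$, are pairwise disjoint. For distinct $u,v\in A$, let $W(u,v)=|N_{\mathcal{G}_0}(u)\cap N_{\mathcal{G}_0}(v)|$;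 the pair $\{u,v\}$ is light if $1\leqslant W(u,v)<2\binom{t}{2}$ and heavy if $W(u,v)\geqslant 2\binom{t}{2}$. -}

module Defs where

open import Data.Nat using (ℕ; zero; suc; _+_; _*_; _≤_; _<_; _<ᵇ_; _≤ᵇ_)
open import Data.Nat.Combinatorics using (_C_)
open import Data.Fin using (Fin)
import Data.Fin as F
open import Data.Bool using (Bool; true; false; _∧_; if_then_else_)
open import Data.List using (List; []; _∷_; map; _++_; length)
open import Data.List.Membership.Propositional using (_∈_)
open import Data.List.Relation.Unary.All using (All)
open import Data.Product using (Σ; _×_; _,_; proj₁; proj₂)
open import Data.Sum using (_⊎_)
open import Relation.Binary.PropositionalEquality using (_≡_; _≢_)

-- Vertices of the auxiliary graph 𝒢 are pairs (a , b) of vertices of G = K_n,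
-- regarded as the 2-set {a , b}.
V𝒢 : ℕ → Set
V𝒢 n = Fin n × Fin n

-- χ : Fin n → Fin n → C is a proper edge-colouring of K_n
-- (values on the diagonal are irrelevant).
IsProperColouring : {C : Set} (n : ℕ) → (Fin n → Fin n → C) → Set
IsProperColouring n χ =
  ((x y : Fin n) → χ x y ≡ χ y x) ×
  ((x y z : Fin n) → x ≢ y → x ≢ z → y ≢ z → χ x y ≢ χ x z)

-- The partition X₁,X₂,X₃,X₄ of V(G) is given by part : Fin n → Fin 4
-- (part x = 0,1,2,3 means x ∈ X₁,X₂,X₃,X₄).
-- Side 1 of 𝒢 is X₁ × X₂, side 2 is X₃ × X₄.
Side₁ : {n : ℕ} → (Fin n → Fin 4) → V𝒢 n → Set
Side₁ part (a , b) = (part a ≡ F.zero) × (part b ≡ F.suc F.zero)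

Side₂ : {n : ℕ} → (Fin n → Fin 4) → V𝒢 n → Set
Side₂ part (a , b) =
  (part a ≡ F.suc (F.suc F.zero)) × (part b ≡ F.suc (F.suc (F.suc F.zero)))

-- Adjacency in 𝒢 between vertices on opposite sides:
-- (x₁,x₂) ~ (x₃,x₄) iff χ(x₁x₃) = χ(x₂x₄).  (Symmetric since χ is.)
Adj𝒢 : {C : Set} {n : ℕ} → (Fin n → Fin n → C) → V𝒢 n → V𝒢 n → Set
Adj𝒢 χ (a₁ , a₂) (b₁ , b₂) = χ a₁ b₁ ≡ χ a₂ b₂

Disjoint : {n : ℕ} → V𝒢 n → V𝒢 n → Set
Disjoint (a₁ , a₂) (b₁ , b₂) =
  (a₁ ≢ b₁) × (a₁ ≢ b₂) × (a₂ ≢ b₁) × (a₂ ≢ b₂)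

countB : {X : Set} → (X → Bool) → List X → ℕ
countB p [] = 0
countB p (x ∷ xs) = if p x then suc (countB p xs) else countB p xs

pairs : {X : Set} → List X → List (X × X)
pairs [] = []
pairs (x ∷ xs) = map (x ,_) xs ++ pairs xs

-- The subgraph 𝒢₀ with parts A and B is given by e0 : V𝒢 → V𝒢 → Bool,
-- where e0 a b = true means that a ∈ A and b ∈ B are adjacent in 𝒢₀.
Edge₀ : {n : ℕ} → (V𝒢 n → V𝒢 n → Bool) → V𝒢 n → V𝒢 n → Set
Edge₀ e0 p q = (e0 p q ≡ true) ⊎ (e0 q p ≡ true)

deg₀ : {n : ℕ} → (V𝒢 n → V𝒢 n → Bool) → List (V𝒢 n) → V𝒢 n → ℕ
deg₀ e0 B a = countB (e0 a) B

W : {n : ℕ} → (V𝒢 n → V𝒢 n → Bool) → List (V𝒢 n) → V𝒢 n → V𝒢 n → ℕ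
W e0 B u v = countB (λ b → e0 u b ∧ e0 v b) B

isLight : {n : ℕ} → ℕ → (V𝒢 n → V𝒢 n → Bool) → List (V𝒢 n) → V𝒢 n × V𝒢 n → Bool
isLight t e0 B (u , v) = (1 ≤ᵇ W e0 B u v) ∧ (W e0 B u v <ᵇ 2 * (t C 2))

lightPairs : {n : ℕ} → ℕ → (V𝒢 n → V𝒢 n → Bool) → List (V𝒢 n) → List (V𝒢 n) → ℕ
lightPairs t e0 B U = countB (isLight t e0 B) (pairs U)

-- A copy of H_t (1-subdivision of K_t) in 𝒢₀ whose vertices are pairwise
-- disjoint 2-sets: branch vertices br i (i : Fin t) and subdivision vertices
-- sd i j for i < j, with sd i j adjacent to br i and br j.
record HtCopy {n : ℕ} (t : ℕ) (e0 : V𝒢 n → V𝒢 n → Bool) : Set where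
  field
    br : Fin t → V𝒢 n
    sd : Fin t → Fin t → V𝒢 n
    edgeˡ : (i j : Fin t) → i F.< j → Edge₀ e0 (br i) (sd i j)
    edgeʳ : (i j : Fin t) → i F.< j → Edge₀ e0 (br j) (sd i j)
    disj-br-br : (i j : Fin t) → i ≢ j → Disjoint (br i) (br j)
    disj-br-sd : (i j k : Fin t) → j F.< k → Disjoint (br i) (sd j k)
    disj-sd-sd : (i j k l : Fin t) → i F.< j → k F.< l →
                 (i , j) ≢ (k , l) → Disjoint (sd i j) (sd k l)

-- For b ∈ B let N(b) ⊆ U be the 𝒢₀-neighbourhood of b, and join two vertices of U when
-- they form a light pair. As χ is proper, vertices with a common 𝒢₀-neighbour are pairwise
-- disjoint 2-sets. Hence t vertices of N(b) that are pairwise non-light are pairwise heavy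
-- (b is a common neighbour) and disjoint, and choosing subdivision vertices greedily among
-- their ≥ 2·C(t,2) common neighbours would give a disjoint copy of H_t. So N(b) has
-- independence number < t, and a Turán-type bound gives |N(b)|² ≤ 2t(e(N(b)) + |N(b)|).
-- Summing over b, each light pair lies in fewer than 2·C(t,2) of the N(b), while
-- Σ|N(b)| ≥ |U|δ ≥ 8tm; Cauchy–Schwarz then yields (|U|δ)² ≤ 8tm · 2·C(t,2) · #light pairs.

module Submission where

open import Defs
open import Data.Bool using (Bool; true; false; _∧_; not; T)
open import Data.Bool.Properties using (∧-comm; T-≡; T-not-≡)
open import Data.Empty using (⊥-elim)
open import Data.Fin using (Fin)
import Data.Fin as F
import Data.Fin.Properties as F
open import Data.List using (List; []; _∷_; _++_; map; length; filter; filterᵇ; allFin; tabulate)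
open import Data.List.Properties using (length-++; length-map; length-tabulate; length-removeAt′; filter-all; filter-accept; filter-reject)
open import Data.List.Membership.Propositional using (_∈_)
open import Data.List.Membership.Propositional.Properties
  using (∈-++⁻; ∈-++⁺ˡ; ∈-++⁺ʳ; ∈-map⁻; ∈-map⁺; ∈-tabulate⁺; ∈-filter⁻)
open import Data.List.Relation.Unary.All as All using (All; []; _∷_)
open import Data.List.Relation.Unary.AllPairs using (AllPairs; []; _∷_)
import Data.List.Relation.Unary.AllPairs.Properties as AllPairsₚ
import Data.List.Relation.Unary.All.Properties as Allₚ
open import Data.List.Relation.Unary.Any using (here; there; index; _─_)
open import Data.List.Relation.Unary.Unique.Propositional using (Unique)
open import Data.Nat using (ℕ; zero; suc; _+_; _*_; _^_; _≤_; _<_; _≤ᵇ_; _<ᵇ_; z≤n; s≤s)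
open import Data.Nat.Combinatorics using (_C_; nC1≡n; nCk+nC[k+1]≡[n+1]C[k+1])
open import Data.Nat.Properties
open import Data.Nat.Tactic.RingSolver using (solve-∀)
open import Algebra.Properties.CommutativeSemigroup +-commutativeSemigroup
  using () renaming (interchange to +-interchange)
open import Data.Product using (Σ; Σ-syntax; ∃-syntax; _×_; _,_; proj₁; proj₂; uncurry)
open import Data.Sum using (_⊎_; inj₁; inj₂)
open import Function using (_∘_; id; Equivalence)
open import Relation.Binary.PropositionalEquality
open import Relation.Nullary using (¬_; Dec; yes; no; ¬?; _⊎-dec_)
open import Relation.Binary.Definitions using (DecidableEquality; tri<; tri≈; tri>)
open import Data.Product.Properties using (≡-dec)
open import Relation.Nullary.Decidable using (T?)
open import Data.Vec.Functional using () renaming (_∷_ to _∷ᶠ_)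

-- Sums and counts over lists

𝟙 : Bool → ℕ
𝟙 true = 1
𝟙 false = 0

∑ : {X : Set} → List X → (X → ℕ) → ℕ
∑ [] f = 0
∑ (x ∷ xs) f = f x + ∑ xs f

syntax ∑ xs (λ x → e) = ∑[ x ← xs ] e

module _ {X : Set} where

  ∑-cong : {f g : X → ℕ} → (∀ x → f x ≡ g x) → (xs : List X) → ∑ xs f ≡ ∑ xs g
  ∑-cong f≗g [] = refl
  ∑-cong f≗g (x ∷ xs) = cong₂ _+_ (f≗g x) (∑-cong f≗g xs)

  ∑-mono : {f g : X → ℕ} → (xs : List X) → (∀ {x} → x ∈ xs → f x ≤ g x) → ∑ xs f ≤ ∑ xs g
  ∑-mono [] f≤g = z≤n
  ∑-mono (x ∷ xs) f≤g = +-mono-≤ (f≤g (here refl)) (∑-mono xs (f≤g ∘ there))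

  ∑-+ : (f g : X → ℕ) → (xs : List X) → ∑[ x ← xs ] (f x + g x) ≡ ∑ xs f + ∑ xs g
  ∑-+ f g [] = refl
  ∑-+ f g (x ∷ xs) rewrite ∑-+ f g xs = +-interchange (f x) (g x) (∑ xs f) (∑ xs g)

  ∑-*ˡ : (c : ℕ) (f : X → ℕ) → (xs : List X) → ∑[ x ← xs ] (c * f x) ≡ c * ∑ xs f
  ∑-*ˡ c f [] = sym (*-zeroʳ c)
  ∑-*ˡ c f (x ∷ xs) rewrite ∑-*ˡ c f xs = sym (*-distribˡ-+ c (f x) (∑ xs f))

  ∑-const : (c : ℕ) → (xs : List X) → ∑[ _ ← xs ] c ≡ length xs * c
  ∑-const c [] = refl
  ∑-const c (x ∷ xs) = cong (c +_) (∑-const c xs)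

∑-swap : {X Y : Set} (f : X → Y → ℕ) (xs : List X) (ys : List Y) →
         ∑[ y ← ys ] ∑[ x ← xs ] f x y ≡ ∑[ x ← xs ] ∑[ y ← ys ] f x y
∑-swap f xs [] = sym (trans (∑-const 0 xs) (*-zeroʳ (length xs)))
∑-swap f xs (y ∷ ys) =
  trans (cong (∑[ x ← xs ] f x y +_) (∑-swap f xs ys)) (sym (∑-+ (λ x → f x y) _ xs))

2xy≤x²+y² : ∀ x y → 2 * x * y ≤ x * x + y * y
2xy≤x²+y² zero y = z≤n
2xy≤x²+y² (suc x) zero = subst (_≤ suc x * suc x + 0) (sym (*-zeroʳ (2 * suc x))) z≤n
2xy≤x²+y² (suc x) (suc y) = begin
    2 * suc x * suc y                    ≡⟨ expand-lhs x y ⟩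
    2 * x * y + 2 * (x + y + 1)          ≤⟨ +-monoˡ-≤ _ (2xy≤x²+y² x y) ⟩
    x * x + y * y + 2 * (x + y + 1)      ≡⟨ expand-rhs x y ⟩
    suc x * suc x + suc y * suc y        ∎
  where
    open ≤-Reasoning
    expand-lhs : ∀ x y → 2 * suc x * suc y ≡ 2 * x * y + 2 * (x + y + 1)
    expand-lhs = solve-∀
    expand-rhs : ∀ x y → x * x + y * y + 2 * (x + y + 1) ≡ suc x * suc x + suc y * suc y
    expand-rhs = solve-∀

-- Sum 2S·(m f x) ≤ S² + (m f x)² over xs, then cancel m.
∑-cauchy-schwarz : {X : Set} (f : X → ℕ) (xs : List X) →
                   ∑ xs f * ∑ xs f ≤ length xs * ∑[ x ← xs ] (f x * f x)
∑-cauchy-schwarz f [] = z≤n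
∑-cauchy-schwarz f xs@(_ ∷ _) = +-cancelˡ-≤ (S * S) _ _ (*-cancelˡ-≤ m m[2S²]≤m[S²+mQ])
  where
    S = ∑ xs f
    Q = ∑[ x ← xs ] (f x * f x)
    m = length xs
    m[2S²]≤m[S²+mQ] : m * (S * S + S * S) ≤ m * (S * S + m * Q)
    m[2S²]≤m[S²+mQ] = begin
      m * (S * S + S * S)                      ≡⟨ lhs m S ⟩
      2 * S * (m * S)                          ≡⟨ cong (2 * S *_) (sym (∑-*ˡ m f xs)) ⟩
      2 * S * ∑[ x ← xs ] (m * f x)            ≡⟨ sym (∑-*ˡ (2 * S) (λ x → m * f x) xs) ⟩
      ∑[ x ← xs ] (2 * S * (m * f x))          ≤⟨ ∑-mono xs (λ {x} _ → 2xy≤x²+y² S (m * f x)) ⟩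
      ∑[ x ← xs ] (S * S + m * f x * (m * f x)) ≡⟨ ∑-+ (λ _ → S * S) _ xs ⟩
      ∑[ _ ← xs ] (S * S) + ∑[ x ← xs ] (m * f x * (m * f x))
        ≡⟨ cong₂ _+_ (∑-const (S * S) xs)
                     (trans (∑-cong (λ x → square-* m (f x)) xs) (∑-*ˡ (m * m) (λ x → f x * f x) xs)) ⟩
      m * (S * S) + m * m * Q                  ≡⟨ rhs m S Q ⟩
      m * (S * S + m * Q)                      ∎
      where
        open ≤-Reasoning
        lhs : ∀ m S → m * (S * S + S * S) ≡ 2 * S * (m * S)
        lhs = solve-∀
        square-* : ∀ a b → a * b * (a * b) ≡ a * a * (b * b)
        square-* = solve-∀
        rhs : ∀ m S Q → m * (S * S) + m * m * Q ≡ m * (S * S + m * Q)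
        rhs = solve-∀

module _ {X : Set} where

  countB≡∑ : (p : X → Bool) (xs : List X) → countB p xs ≡ ∑[ x ← xs ] 𝟙 (p x)
  countB≡∑ p [] = refl
  countB≡∑ p (x ∷ xs) with p x
  ... | true = cong suc (countB≡∑ p xs)
  ... | false = countB≡∑ p xs

  countB-cong : {p q : X → Bool} → (∀ x → p x ≡ q x) → (xs : List X) → countB p xs ≡ countB q xs
  countB-cong {p} {q} p≗q xs =
    trans (countB≡∑ p xs) (trans (∑-cong (cong 𝟙 ∘ p≗q) xs) (sym (countB≡∑ q xs)))

  countB-∷ : (p : X → Bool) (x : X) (xs : List X) → countB p (x ∷ xs) ≡ 𝟙 (p x) + countB p xs
  countB-∷ p x xs with p x
  ... | true = refl
  ... | false = refl

  countB-false : (xs : List X) → countB (λ _ → false) xs ≡ 0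
  countB-false [] = refl
  countB-false (x ∷ xs) = countB-false xs

  countB+countB-not : (p : X → Bool) (xs : List X) → countB p xs + countB (not ∘ p) xs ≡ length xs
  countB+countB-not p [] = refl
  countB+countB-not p (x ∷ xs) with p x
  ... | true = cong suc (countB+countB-not p xs)
  ... | false = trans (+-suc _ _) (cong suc (countB+countB-not p xs))

  countB-∈ : (p : X → Bool) {x : X} {xs : List X} → x ∈ xs → p x ≡ true → 1 ≤ countB p xs
  countB-∈ p {xs = y ∷ ys} (here refl) px rewrite px = s≤s z≤n
  countB-∈ p {xs = y ∷ ys} (there x∈) px with p y
  ... | true = s≤s z≤n
  ... | false = countB-∈ p x∈ px

  countB-─ : (p : X → Bool) {x : X} {xs : List X} (x∈ : x ∈ xs) →
             countB p xs ≡ 𝟙 (p x) + countB p (xs ─ x∈)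
  countB-─ p {xs = y ∷ ys} (here refl) with p y
  ... | true = refl
  ... | false = refl
  countB-─ p {x} {y ∷ ys} (there x∈) with p y
  ... | true = trans (cong suc (countB-─ p x∈)) (sym (+-suc (𝟙 (p x)) _))
  ... | false = countB-─ p x∈

  countB-++ : (p : X → Bool) (xs ys : List X) → countB p (xs ++ ys) ≡ countB p xs + countB p ys
  countB-++ p [] ys = refl
  countB-++ p (x ∷ xs) ys with p x
  ... | true = cong suc (countB-++ p xs ys)
  ... | false = countB-++ p xs ys

  ∈-filterᵇ⁻ : (p : X → Bool) {x : X} {xs : List X} → x ∈ filterᵇ p xs → x ∈ xs × p x ≡ true
  ∈-filterᵇ⁻ p x∈ with ∈-filter⁻ (T? ∘ p) x∈
  ... | x∈xs , px = x∈xs , Equivalence.to T-≡ px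

  length-filterᵇ : (p : X → Bool) (xs : List X) → length (filterᵇ p xs) ≡ countB p xs
  length-filterᵇ p [] = refl
  length-filterᵇ p (x ∷ xs) with p x
  ... | true = cong suc (length-filterᵇ p xs)
  ... | false = length-filterᵇ p xs

  countB-filterᵇ : (q p : X → Bool) (xs : List X) →
                   countB q (filterᵇ p xs) ≡ countB (λ x → p x ∧ q x) xs
  countB-filterᵇ q p [] = refl
  countB-filterᵇ q p (x ∷ xs) with p x
  ... | false = countB-filterᵇ q p xs
  ... | true with q x
  ...   | true  = cong suc (countB-filterᵇ q p xs)
  ...   | false = countB-filterᵇ q p xs

  countB-filterᵇ-≤ : (q p : X → Bool) (xs : List X) → countB q (filterᵇ p xs) ≤ countB q xs
  countB-filterᵇ-≤ q p [] = z≤n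
  countB-filterᵇ-≤ q p (x ∷ xs) with p x
  ... | true with q x
  ...   | true  = s≤s (countB-filterᵇ-≤ q p xs)
  ...   | false = countB-filterᵇ-≤ q p xs
  countB-filterᵇ-≤ q p (x ∷ xs) | false with q x
  ...   | true  = m≤n⇒m≤1+n (countB-filterᵇ-≤ q p xs)
  ...   | false = countB-filterᵇ-≤ q p xs

countB-map : {X Y : Set} (p : Y → Bool) (f : X → Y) (xs : List X) →
             countB p (map f xs) ≡ countB (p ∘ f) xs
countB-map p f [] = refl
countB-map p f (x ∷ xs) with p (f x)
... | true = cong suc (countB-map p f xs)
... | false = countB-map p f xs

∑-countB-swap : {X Y : Set} (R : X → Y → Bool) (xs : List X) (ys : List Y) →
                ∑[ y ← ys ] countB (λ x → R x y) xs ≡ ∑[ x ← xs ] countB (R x) ys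
∑-countB-swap R xs ys = begin
  ∑[ y ← ys ] countB (λ x → R x y) xs     ≡⟨ ∑-cong (λ y → countB≡∑ (λ x → R x y) xs) ys ⟩
  ∑[ y ← ys ] ∑[ x ← xs ] 𝟙 (R x y)       ≡⟨ ∑-swap (λ x y → 𝟙 (R x y)) xs ys ⟩
  ∑[ x ← xs ] ∑[ y ← ys ] 𝟙 (R x y)       ≡⟨ ∑-cong (λ x → sym (countB≡∑ (R x) ys)) xs ⟩
  ∑[ x ← xs ] countB (R x) ys             ∎
  where open ≡-Reasoning

[1+n]C2≡n+nC2 : ∀ n → suc n C 2 ≡ n + n C 2
[1+n]C2≡n+nC2 n = trans (sym (nCk+nC[k+1]≡[n+1]C[k+1] n 1)) (cong (_+ n C 2) (nC1≡n n))

2*nC2≤n*n : ∀ n → 2 * (n C 2) ≤ n * n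
2*nC2≤n*n zero = z≤n
2*nC2≤n*n (suc n) = begin
  2 * (suc n C 2)         ≡⟨ cong (2 *_) ([1+n]C2≡n+nC2 n) ⟩
  2 * (n + n C 2)         ≡⟨ *-distribˡ-+ 2 n (n C 2) ⟩
  2 * n + 2 * (n C 2)     ≤⟨ +-monoʳ-≤ (2 * n) (2*nC2≤n*n n) ⟩
  2 * n + n * n           <⟨ n<1+n _ ⟩
  suc (2 * n + n * n)     ≡⟨ square-suc n ⟩
  suc n * suc n           ∎
  where
    open ≤-Reasoning
    square-suc : ∀ n → suc (2 * n + n * n) ≡ suc n * suc n
    square-suc = solve-∀

module _ {X : Set} where

  length-pairs : (xs : List X) → length (pairs xs) ≡ length xs C 2
  length-pairs [] = refl
  length-pairs (x ∷ xs) = begin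
    length (map (x ,_) xs ++ pairs xs)        ≡⟨ length-++ (map (x ,_) xs) ⟩
    length (map (x ,_) xs) + length (pairs xs) ≡⟨ cong₂ _+_ (length-map (x ,_) xs) (length-pairs xs) ⟩
    length xs + length xs C 2                  ≡⟨ sym ([1+n]C2≡n+nC2 (length xs)) ⟩
    suc (length xs) C 2                        ∎
    where open ≡-Reasoning

  pairs-sound : {R : X → X → Set} {xs : List X} → AllPairs R xs →
                ∀ {q} → q ∈ pairs xs → R (proj₁ q) (proj₂ q)
  pairs-sound {xs = x ∷ xs} (Rx ∷ Rxs) q∈ with ∈-++⁻ (map (x ,_) xs) q∈
  ... | inj₂ q∈pairs = pairs-sound Rxs q∈pairs
  ... | inj₁ q∈map with ∈-map⁻ (x ,_) q∈map
  ...   | y , y∈xs , refl = All.lookup Rx y∈xs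

  pairs-tabulate⁺ : ∀ {n} (f : Fin n → X) {i j : Fin n} → i F.< j → (f i , f j) ∈ pairs (tabulate f)
  pairs-tabulate⁺ {suc n} f {F.zero} {F.suc j} _ =
    ∈-++⁺ˡ (∈-map⁺ (f F.zero ,_) (∈-tabulate⁺ {f = f ∘ F.suc} j))
  pairs-tabulate⁺ {suc n} f {F.suc i} {F.suc j} (s≤s i<j) =
    ∈-++⁺ʳ (map (f F.zero ,_) _) (pairs-tabulate⁺ (f ∘ F.suc) i<j)

  countB-pairs-filterᵇ : (r : X × X → Bool) (p : X → Bool) (xs : List X) →
    countB r (pairs (filterᵇ p xs)) ≡ countB (λ q → (p (proj₁ q) ∧ p (proj₂ q)) ∧ r q) (pairs xs)
  countB-pairs-filterᵇ r p [] = refl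
  countB-pairs-filterᵇ r p (x ∷ xs) with p x in px
  ... | true = begin
      countB r (map (x ,_) (filterᵇ p xs) ++ pairs (filterᵇ p xs))
        ≡⟨ countB-++ r (map (x ,_) (filterᵇ p xs)) _ ⟩
      countB r (map (x ,_) (filterᵇ p xs)) + countB r (pairs (filterᵇ p xs))
        ≡⟨ cong₂ _+_ (trans (countB-map r (x ,_) (filterᵇ p xs)) (countB-filterᵇ (r ∘ (x ,_)) p xs))
                     (countB-pairs-filterᵇ r p xs) ⟩
      countB (λ y → p y ∧ r (x , y)) xs + countB r′ (pairs xs)
        ≡⟨ cong (_+ countB r′ (pairs xs)) (sym (countB-with-x px)) ⟩
      countB r′ (map (x ,_) xs) + countB r′ (pairs xs)
        ≡⟨ sym (countB-++ r′ (map (x ,_) xs) _) ⟩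
      countB r′ (map (x ,_) xs ++ pairs xs) ∎
    where
      open ≡-Reasoning
      r′ = λ q → (p (proj₁ q) ∧ p (proj₂ q)) ∧ r q
      countB-with-x : p x ≡ true → countB r′ (map (x ,_) xs) ≡ countB (λ y → p y ∧ r (x , y)) xs
      countB-with-x px = trans (countB-map r′ (x ,_) xs)
                               (countB-cong (λ y → cong (λ b → (b ∧ p y) ∧ r (x , y)) px) xs)
  ... | false = begin
      countB r (pairs (filterᵇ p xs))
        ≡⟨ countB-pairs-filterᵇ r p xs ⟩
      countB r′ (pairs xs)
        ≡⟨ cong (_+ countB r′ (pairs xs)) (sym (countB-without-x px)) ⟩
      countB r′ (map (x ,_) xs) + countB r′ (pairs xs)
        ≡⟨ sym (countB-++ r′ (map (x ,_) xs) _) ⟩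
      countB r′ (map (x ,_) xs ++ pairs xs) ∎
    where
      open ≡-Reasoning
      r′ = λ q → (p (proj₁ q) ∧ p (proj₂ q)) ∧ r q
      countB-without-x : p x ≡ false → countB r′ (map (x ,_) xs) ≡ 0
      countB-without-x px = trans (countB-map r′ (x ,_) xs)
        (trans (countB-cong (λ y → cong (λ b → (b ∧ p y) ∧ r (x , y)) px) xs) (countB-false xs))

-- A Turán-type bound for graphs of small independence number

AllPairs-─ : {X : Set} {R : X → X → Set} {x : X} {xs : List X} (x∈ : x ∈ xs) →
             AllPairs R xs → AllPairs R (xs ─ x∈)
AllPairs-─ (here refl) (_ ∷ Rxs) = Rxs
AllPairs-─ (there x∈) (Rx ∷ Rxs) = Allₚ.─⁺ x∈ Rx ∷ AllPairs-─ x∈ Rxs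

∈-─⁻ : {X : Set} {x y : X} {xs : List X} (x∈ : x ∈ xs) → y ∈ (xs ─ x∈) → y ∈ xs
∈-─⁻ (here _) y∈ = there y∈
∈-─⁻ (there _) (here refl) = here refl
∈-─⁻ (there x∈) (there y∈) = there (∈-─⁻ x∈ y∈)

a+r≰[1+k]a⇒a+r≤[1+k]y : ∀ k a r y → ¬ (a + r ≤ suc k * a) → r ≤ k * y → a + r ≤ suc k * y
a+r≰[1+k]a⇒a+r≤[1+k]y k a r y a+r≰ r≤ky with a ≤? y
... | yes a≤y = +-mono-≤ a≤y r≤ky
... | no a≰y = ⊥-elim (a+r≰ (+-monoʳ-≤ a (≤-trans r≤ky (*-monoʳ-≤ k (<⇒≤ (≰⇒> a≰y))))))

turán-step : ∀ k d g e → d * d ≤ 2 * suc k * (e + d) → suc d ≤ k * suc g →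
             suc d * suc d ≤ 2 * suc k * ((g + e) + suc d)
turán-step k d g e d²≤ d<k[g+1] = begin
  suc d * suc d                          ≡⟨ square-suc d ⟩
  d * d + (d + suc d)                    ≤⟨ +-mono-≤ d²≤ (≤-trans (+-monoˡ-≤ (suc d) (n≤1+n d)) twice) ⟩
  2 * suc k * (e + d) + 2 * (k * suc g)  ≤⟨ +-monoʳ-≤ _ (≤-reflexive (sym (*-assoc 2 k (suc g)))) ⟩
  2 * suc k * (e + d) + 2 * k * suc g    ≤⟨ +-monoʳ-≤ _ (*-monoˡ-≤ (suc g) (*-monoʳ-≤ 2 (n≤1+n k))) ⟩
  2 * suc k * (e + d) + 2 * suc k * suc g ≡⟨ regroup (2 * suc k) d g e ⟩
  2 * suc k * ((g + e) + suc d)          ∎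
  where
    open ≤-Reasoning
    square-suc : ∀ d → suc d * suc d ≡ d * d + (d + suc d)
    square-suc = solve-∀
    twice : suc d + suc d ≤ 2 * (k * suc g)
    twice = ≤-trans (+-mono-≤ d<k[g+1] d<k[g+1]) (≤-reflexive (cong (k * suc g +_) (sym (+-identityʳ _))))
    regroup : ∀ c d g e → c * (e + d) + c * suc g ≡ c * ((g + e) + suc d)
    regroup = solve-∀

module IndependentSets {X : Set} (L : X → X → Bool) where

  degree : X → List X → ℕ
  degree x D = countB (L x) D

  edges : List X → ℕ
  edges D = countB (uncurry L) (pairs D)

  IsIndependent : List X → {k : ℕ} → (Fin k → X) → Set
  IsIndependent D f = (∀ i → f i ∈ D) × (∀ {i j} → i F.< j → f i ≢ f j × L (f i) (f j) ≡ false)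

  α[_]<_ : List X → ℕ → Set
  α[ D ]< k = (f : Fin k → X) → ¬ IsIndependent D f

  α<-⊆ : ∀ {k D D′} → (∀ {x} → x ∈ D′ → x ∈ D) → α[ D ]< k → α[ D′ ]< k
  α<-⊆ D′⊆D α< f (f∈D′ , independent) = α< f (D′⊆D ∘ f∈D′ , independent)

  α<-nonNeighbours : ∀ {k x xs} → Unique (x ∷ xs) → α[ x ∷ xs ]< suc k →
                     α[ filterᵇ (not ∘ L x) xs ]< k
  α<-nonNeighbours {k} {x} {xs} (x∉xs ∷ _) α< f (f∈R , independent) = α< (x ∷ᶠ f) (∈D , independent′)
    where
      nonNeighbour : ∀ i → f i ∈ xs × L x (f i) ≡ false
      nonNeighbour i with ∈-filter⁻ (T? ∘ (not ∘ L x)) (f∈R i)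
      ... | f∈xs , ¬L = f∈xs , Equivalence.to T-not-≡ ¬L
      ∈D : ∀ i → (x ∷ᶠ f) i ∈ x ∷ xs
      ∈D F.zero = here refl
      ∈D (F.suc i) = there (proj₁ (nonNeighbour i))
      independent′ : ∀ {i j} → i F.< j → (x ∷ᶠ f) i ≢ (x ∷ᶠ f) j × L ((x ∷ᶠ f) i) ((x ∷ᶠ f) j) ≡ false
      independent′ {F.zero} {F.suc j} _ = All.lookup x∉xs (proj₁ (nonNeighbour j)) , proj₂ (nonNeighbour j)
      independent′ {F.suc i} {F.suc j} (s≤s i<j) = independent i<j

  -- Either x will do, or its non-neighbours have no independent k-set and we recurse there.
  -- Degrees are taken after deleting v, so that L need not be irreflexive.
  dense-vertex : ∀ k (D : List X) → 0 < length D → Unique D → α[ D ]< suc k →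
                 ∃[ v ] Σ (v ∈ D) λ v∈D → length D ≤ k * suc (degree v (D ─ v∈D))
  dense-vertex zero (x ∷ xs) _ _ α< = ⊥-elim (α< (λ _ → x) ((λ _ → here refl) , λ { {F.zero} {F.zero} () }))
  dense-vertex (suc k) (x ∷ xs) _ uniq@(_ ∷ uniq-xs) α< with length (x ∷ xs) ≤? suc k * suc (degree x xs)
  ... | yes x-dense = x , here refl , x-dense
  ... | no x-sparse = v , there v∈xs , bound
    where
      R = filterᵇ (not ∘ L x) xs
      |xs|≡ : length xs ≡ degree x xs + length R
      |xs|≡ = trans (sym (countB+countB-not (L x) xs)) (cong (degree x xs +_) (sym (length-filterᵇ _ xs)))
      0<|R| : 0 < length R
      0<|R| = n≢0⇒n>0 λ |R|≡0 → x-sparse (subst (_≤ suc k * suc (degree x xs))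
        (cong suc (sym (trans |xs|≡ (trans (cong (degree x xs +_) |R|≡0) (+-identityʳ _)))))
        (m≤n*m (suc (degree x xs)) (suc k)))
      rec = dense-vertex k R 0<|R| (AllPairsₚ.filter⁺ (T? ∘ (not ∘ L x)) uniq-xs) (α<-nonNeighbours uniq α<)
      v = proj₁ rec
      v∈R = proj₁ (proj₂ rec)
      v∈xs = proj₁ (∈-filterᵇ⁻ _ v∈R)
      degree-mono : degree v (R ─ v∈R) ≤ degree v (x ∷ (xs ─ v∈xs))
      degree-mono = +-cancelˡ-≤ (𝟙 (L v v)) _ _ (begin
        𝟙 (L v v) + degree v (R ─ v∈R)       ≡⟨ sym (countB-─ (L v) v∈R) ⟩
        degree v R                            ≤⟨ countB-filterᵇ-≤ (L v) _ xs ⟩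
        degree v xs                           ≡⟨ countB-─ (L v) v∈xs ⟩
        𝟙 (L v v) + degree v (xs ─ v∈xs)     ≤⟨ +-monoʳ-≤ (𝟙 (L v v)) (≤-trans (m≤n+m _ (𝟙 (L v x)))
                                                  (≤-reflexive (sym (countB-∷ (L v) x (xs ─ v∈xs))))) ⟩
        𝟙 (L v v) + degree v (x ∷ (xs ─ v∈xs)) ∎)
        where open ≤-Reasoning
      bound : length (x ∷ xs) ≤ suc k * suc (degree v (x ∷ (xs ─ v∈xs)))
      bound = subst (_≤ suc k * suc (degree v (x ∷ (xs ─ v∈xs)))) (cong suc (sym |xs|≡))
        (≤-trans (a+r≰[1+k]a⇒a+r≤[1+k]y k (suc (degree x xs)) (length R) _
                    (x-sparse ∘ subst (_≤ suc k * suc (degree x xs)) (cong suc (sym |xs|≡))) (proj₂ (proj₂ rec)))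
                 (*-monoʳ-≤ (suc k) (s≤s degree-mono)))

  edges-∷ : ∀ x xs → edges (x ∷ xs) ≡ degree x xs + edges xs
  edges-∷ x xs = trans (countB-++ (uncurry L) (map (x ,_) xs) (pairs xs))
                       (cong (_+ edges xs) (countB-map (uncurry L) (x ,_) xs))

  module _ (L-sym : ∀ x y → L x y ≡ L y x) where

    edges-─ : ∀ {v D} (v∈D : v ∈ D) → edges D ≡ degree v (D ─ v∈D) + edges (D ─ v∈D)
    edges-─ {D = x ∷ xs} (here refl) = edges-∷ x xs
    edges-─ {v} {x ∷ xs} (there v∈xs) = begin
      edges (x ∷ xs)                                              ≡⟨ edges-∷ x xs ⟩
      degree x xs + edges xs                                      ≡⟨ cong₂ _+_ (countB-─ (L x) v∈xs) (edges-─ v∈xs) ⟩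
      (𝟙 (L x v) + degree x xs′) + (degree v xs′ + edges xs′)     ≡⟨ cong (λ b → (𝟙 b + degree x xs′) + (degree v xs′ + edges xs′)) (L-sym x v) ⟩
      (𝟙 (L v x) + degree x xs′) + (degree v xs′ + edges xs′)     ≡⟨ +-interchange (𝟙 (L v x)) (degree x xs′) (degree v xs′) (edges xs′) ⟩
      (𝟙 (L v x) + degree v xs′) + (degree x xs′ + edges xs′)     ≡⟨ cong₂ _+_ (sym (countB-∷ (L v) x xs′)) (sym (edges-∷ x xs′)) ⟩
      degree v (x ∷ xs′) + edges (x ∷ xs′)                        ∎
      where
        open ≡-Reasoning
        xs′ = xs ─ v∈xs

    turán : ∀ t D → Unique D → α[ D ]< t → length D * length D ≤ 2 * t * (edges D + length D)
    turán t D = go t (length D) D refl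
      where
        go : ∀ t n D → length D ≡ n → Unique D → α[ D ]< t → length D * length D ≤ 2 * t * (edges D + length D)
        go zero _ D _ _ α< = ⊥-elim (α< (λ ()) ((λ ()) , λ {i} → ⊥-elim (F.¬Fin0 i)))
        go (suc k) _ [] _ _ _ = z≤n
        go (suc k) (suc n) D@(_ ∷ _) |D|≡ uniq α< = subst₂ (λ l e → l * l ≤ 2 * suc k * (e + l))
            (sym |D|≡|D′|+1) (sym (edges-─ v∈D))
            (turán-step k (length D′) (degree v D′) (edges D′) ih
               (subst (_≤ k * suc (degree v D′)) |D|≡|D′|+1 (proj₂ (proj₂ dense))))
          where
            dense = dense-vertex k D (s≤s z≤n) uniq α<
            v = proj₁ dense
            v∈D = proj₁ (proj₂ dense)
            D′ = D ─ v∈D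
            |D|≡|D′|+1 : length D ≡ suc (length D′)
            |D|≡|D′|+1 = length-removeAt′ D (index v∈D)
            ih = go (suc k) n D′ (suc-injective (trans (sym |D|≡|D′|+1) |D|≡)) (AllPairs-─ v∈D uniq)
                    (α<-⊆ (λ x∈ → ∈-─⁻ v∈D x∈) α<)

-- Disjoint representatives and copies of H_t

∧≡true⁻ : ∀ {a b} → a ∧ b ≡ true → a ≡ true × b ≡ true
∧≡true⁻ {true} {true} _ = refl , refl

AllPairs-∈ : {X : Set} {R : X → X → Set} {xs : List X} → Unique xs →
             (∀ {x y} → x ∈ xs → y ∈ xs → x ≢ y → R x y) → AllPairs R xs
AllPairs-∈ [] _ = []
AllPairs-∈ (x∉xs ∷ uniq) R-∈ =
  All.tabulate (λ y∈ → R-∈ (here refl) (there y∈) (All.lookup x∉xs y∈))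
  ∷ AllPairs-∈ uniq (λ x∈ y∈ → R-∈ (there x∈) (there y∈))

module _ {n : ℕ} where

  _∈ᵥ_ : Fin n → V𝒢 n → Set
  x ∈ᵥ c = x ≡ proj₁ c ⊎ x ≡ proj₂ c

  _∈ᵥ?_ : (x : Fin n) (c : V𝒢 n) → Dec (x ∈ᵥ c)
  x ∈ᵥ? c = (x F.≟ proj₁ c) ⊎-dec (x F.≟ proj₂ c)

  Disjoint-sym : {c d : V𝒢 n} → Disjoint c d → Disjoint d c
  Disjoint-sym (c₁≢d₁ , c₁≢d₂ , c₂≢d₁ , c₂≢d₂) = c₁≢d₁ ∘ sym , c₂≢d₁ ∘ sym , c₁≢d₂ ∘ sym , c₂≢d₂ ∘ sym

  Disjoint⇒∉ : {c d : V𝒢 n} {x : Fin n} → Disjoint c d → x ∈ᵥ c → ¬ x ∈ᵥ d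
  Disjoint⇒∉ (c₁≢d₁ , _ , _ , _) (inj₁ refl) (inj₁ refl) = c₁≢d₁ refl
  Disjoint⇒∉ (_ , c₁≢d₂ , _ , _) (inj₁ refl) (inj₂ refl) = c₁≢d₂ refl
  Disjoint⇒∉ (_ , _ , c₂≢d₁ , _) (inj₂ refl) (inj₁ refl) = c₂≢d₁ refl
  Disjoint⇒∉ (_ , _ , _ , c₂≢d₂) (inj₂ refl) (inj₂ refl) = c₂≢d₂ refl

  ∉⇒Disjoint : {c d : V𝒢 n} → ¬ proj₁ c ∈ᵥ d → ¬ proj₂ c ∈ᵥ d → Disjoint c d
  ∉⇒Disjoint c₁∉d c₂∉d = c₁∉d ∘ inj₁ , c₁∉d ∘ inj₂ , c₂∉d ∘ inj₁ , c₂∉d ∘ inj₂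

  avoiding : Fin n → List (V𝒢 n) → List (V𝒢 n)
  avoiding x = filter (λ c → ¬? (x ∈ᵥ? c))

  length-avoiding : (x : Fin n) {cs : List (V𝒢 n)} → AllPairs Disjoint cs →
                    length cs ≤ suc (length (avoiding x cs))
  length-avoiding x {[]} [] = z≤n
  length-avoiding x {c ∷ cs} (c-disj ∷ cs-disj) with x ∈ᵥ? c
  ... | yes x∈c = s≤s (≤-reflexive (cong length (sym (begin
          avoiding x (c ∷ cs)  ≡⟨ filter-reject (λ c′ → ¬? (x ∈ᵥ? c′)) (λ x∉c → x∉c x∈c) ⟩
          avoiding x cs        ≡⟨ filter-all (λ c′ → ¬? (x ∈ᵥ? c′)) (All.map (λ c#c′ → Disjoint⇒∉ c#c′ x∈c) c-disj) ⟩
          cs                   ∎))))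
    where open ≡-Reasoning
  ... | no x∉c = subst (λ cs′ → suc (length cs) ≤ suc (length cs′))
                   (sym (filter-accept (λ c′ → ¬? (x ∈ᵥ? c′)) x∉c)) (s≤s (length-avoiding x cs-disj))

  disjoint-member : (rs : List (V𝒢 n)) {cs : List (V𝒢 n)} → AllPairs Disjoint cs →
                    2 * length rs < length cs → ∃[ c ] c ∈ cs × All (Disjoint c) rs
  disjoint-member [] {c ∷ _} _ _ = c , here refl , []
  disjoint-member (r ∷ rs) {cs} cs-disj |cs|> with disjoint-member rs cs″-disj |cs″|>
    where
      cs′ = avoiding (proj₁ r) cs
      cs″ = avoiding (proj₂ r) cs′
      cs′-disj = AllPairsₚ.filter⁺ (λ c → ¬? (proj₁ r ∈ᵥ? c)) cs-disj
      cs″-disj = AllPairsₚ.filter⁺ (λ c → ¬? (proj₂ r ∈ᵥ? c)) cs′-disj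
      |cs″|> : 2 * length rs < length cs″
      |cs″|> = +-cancelˡ-≤ 2 _ _ (begin
        2 + suc (2 * length rs)     ≡⟨ cong suc (sym (*-suc 2 (length rs))) ⟩
        suc (2 * length (r ∷ rs))   ≤⟨ |cs|> ⟩
        length cs                   ≤⟨ length-avoiding (proj₁ r) cs-disj ⟩
        suc (length cs′)            ≤⟨ s≤s (length-avoiding (proj₂ r) cs′-disj) ⟩
        2 + length cs″              ∎)
        where open ≤-Reasoning
  ... | c , c∈cs″ , c#rs with ∈-filter⁻ (λ c → ¬? (proj₂ r ∈ᵥ? c)) c∈cs″
  ...   | c∈cs′ , r₂∉c with ∈-filter⁻ (λ c → ¬? (proj₁ r ∈ᵥ? c)) c∈cs′
  ...     | c∈cs , r₁∉c = c , c∈cs , Disjoint-sym (∉⇒Disjoint r₁∉c r₂∉c) ∷ c#rs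

  -- Greedy: by length-avoiding, each earlier representative rules out at most two candidates.
  module _ {K : Set} (_≟_ : DecidableEquality K) (candidates : K → List (V𝒢 n)) where

    disjoint-representatives : (fallback : K → V𝒢 n) (P : List K) →
      (∀ {k} → k ∈ P → AllPairs Disjoint (candidates k) × 2 * length P ≤ length (candidates k)) →
      Σ[ rep ∈ (K → V𝒢 n) ] (∀ {k} → k ∈ P → rep k ∈ candidates k)
                           × (∀ {k l} → k ∈ P → l ∈ P → k ≢ l → Disjoint (rep k) (rep l))
    disjoint-representatives fallback [] _ = fallback , (λ ()) , (λ ())
    disjoint-representatives fallback (k ∷ P) cands = rep , rep∈ , rep-disj
      where
        rec = disjoint-representatives fallback P λ l∈P →
          proj₁ (cands (there l∈P)) , ≤-trans (*-monoʳ-≤ 2 (n≤1+n (length P))) (proj₂ (cands (there l∈P)))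
        rep′ = proj₁ rec
        room : 2 * length (map rep′ P) < length (candidates k)
        room = begin-strict
          2 * length (map rep′ P)  ≡⟨ cong (2 *_) (length-map rep′ P) ⟩
          2 * length P             <⟨ *-monoʳ-< 2 (n<1+n (length P)) ⟩
          2 * suc (length P)       ≤⟨ proj₂ (cands (here refl)) ⟩
          length (candidates k)    ∎
          where open ≤-Reasoning
        new = disjoint-member (map rep′ P) (proj₁ (cands (here refl))) room
        c = proj₁ new

        rep : K → V𝒢 n
        rep l with l ≟ k
        ... | yes _ = c
        ... | no _ = rep′ l

        in-tail : ∀ {l} → l ∈ k ∷ P → l ≢ k → l ∈ P
        in-tail (here l≡k) l≢k = ⊥-elim (l≢k l≡k)
        in-tail (there l∈P) _ = l∈P

        c#rep′ : ∀ {l} → l ∈ P → Disjoint c (rep′ l)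
        c#rep′ l∈P = All.lookup (proj₂ (proj₂ new)) (∈-map⁺ rep′ l∈P)

        rep∈ : ∀ {l} → l ∈ k ∷ P → rep l ∈ candidates l
        rep∈ {l} l∈ with l ≟ k
        ... | yes refl = proj₁ (proj₂ new)
        ... | no l≢k = proj₁ (proj₂ rec) (in-tail l∈ l≢k)

        rep-disj : ∀ {l l′} → l ∈ k ∷ P → l′ ∈ k ∷ P → l ≢ l′ → Disjoint (rep l) (rep l′)
        rep-disj {l} {l′} l∈ l′∈ l≢l′ with l ≟ k | l′ ≟ k
        ... | yes refl | yes refl = ⊥-elim (l≢l′ refl)
        ... | yes refl | no l′≢k = c#rep′ (in-tail l′∈ l′≢k)
        ... | no l≢k | yes refl = Disjoint-sym (c#rep′ (in-tail l∈ l≢k))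
        ... | no l≢k | no l′≢k = proj₂ (proj₂ rec) (in-tail l∈ l≢k) (in-tail l′∈ l′≢k) l≢l′

module _ {n : ℕ} (t : ℕ) (e0 : V𝒢 n → V𝒢 n → Bool) (B : List (V𝒢 n)) where

  heavy-branches⇒HtCopy : Unique B →
    (∀ {a c c′} → e0 a c ≡ true → e0 a c′ ≡ true → c ≢ c′ → Disjoint c c′) →
    (br : Fin t → V𝒢 n) →
    (∀ {i j} → i ≢ j → Disjoint (br i) (br j)) →
    (∀ i {c} → c ∈ B → Disjoint (br i) c) →
    (∀ {i j} → i F.< j → 2 * (t C 2) ≤ W e0 B (br i) (br j)) →
    HtCopy t e0
  heavy-branches⇒HtCopy uniq neighbours-disjoint br br-disj br#B heavy = record
    { br = br
    ; sd = sd
    ; edgeˡ = λ i j i<j → inj₁ (proj₁ (sd-edges i<j))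
    ; edgeʳ = λ i j i<j → inj₁ (proj₂ (sd-edges i<j))
    ; disj-br-br = λ i j → br-disj
    ; disj-br-sd = λ i j k j<k → br#B i (proj₁ (sd∈ j<k))
    ; disj-sd-sd = λ i j k l i<j k<l → proj₂ (proj₂ reps) (index-pair i<j) (index-pair k<l)
    }
    where
      P : List (Fin t × Fin t)
      P = pairs (allFin t)
      index-pair : ∀ {i j} → i F.< j → (i , j) ∈ P
      index-pair = pairs-tabulate⁺ id
      shared : Fin t × Fin t → V𝒢 n → Bool
      shared (i , j) c = e0 (br i) c ∧ e0 (br j) c
      candidates : Fin t × Fin t → List (V𝒢 n)
      candidates k = filterᵇ (shared k) B
      candidates-ok : ∀ {k} → k ∈ P → AllPairs Disjoint (candidates k) × 2 * length P ≤ length (candidates k)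
      candidates-ok {k} k∈P =
        AllPairs-∈ (AllPairsₚ.filter⁺ (T? ∘ shared k) uniq)
          (λ c∈ c′∈ → neighbours-disjoint (proj₁ (∧≡true⁻ (proj₂ (∈-filterᵇ⁻ (shared k) {xs = B} c∈))))
                                          (proj₁ (∧≡true⁻ (proj₂ (∈-filterᵇ⁻ (shared k) {xs = B} c′∈))))) ,
        subst₂ (λ p c → 2 * p ≤ c)
          (sym (trans (length-pairs (allFin t)) (cong (_C 2) (length-tabulate {n = t} id))))
          (sym (length-filterᵇ (shared k) B))
          (heavy (pairs-sound {xs = allFin t} (AllPairsₚ.tabulate⁺-< {R = F._<_} id) k∈P))
      -- The fallback br ∘ proj₁ only fills sd i j for i ≥ j, which HtCopy never inspects.
      reps = disjoint-representatives (≡-dec F._≟_ F._≟_) candidates (br ∘ proj₁) P candidates-ok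
      sd : Fin t → Fin t → V𝒢 n
      sd i j = proj₁ reps (i , j)
      sd∈ : ∀ {i j} → i F.< j → sd i j ∈ B × (e0 (br i) (sd i j) ∧ e0 (br j) (sd i j) ≡ true)
      sd∈ {i} {j} i<j = ∈-filterᵇ⁻ (shared (i , j)) (proj₁ (proj₂ reps) (index-pair i<j))
      sd-edges : ∀ {i j} → i F.< j → e0 (br i) (sd i j) ≡ true × e0 (br j) (sd i j) ≡ true
      sd-edges = ∧≡true⁻ ∘ proj₂ ∘ sd∈

-- The auxiliary graph 𝒢

module _ {n : ℕ} {Col : Set} {χ : Fin n → Fin n → Col} (proper : IsProperColouring n χ) where

  Adj𝒢-sym : {p c : V𝒢 n} → Adj𝒢 χ p c → Adj𝒢 χ c p
  Adj𝒢-sym {p} {c} adj = trans (proj₁ proper (proj₁ c) (proj₁ p)) (trans adj (proj₁ proper (proj₂ p) (proj₂ c)))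

  -- Two edges of G at the same vertex have different colours, so a common neighbour p
  -- of c and c′ in 𝒢 forces c, c′ to differ in both coordinates.
  common-neighbours-apart : {p c c′ : V𝒢 n} → Disjoint p c → Disjoint p c′ →
    Adj𝒢 χ p c → Adj𝒢 χ p c′ → c ≢ c′ → proj₁ c ≢ proj₁ c′ × proj₂ c ≢ proj₂ c′
  common-neighbours-apart {p₁ , p₂} {c₁ , c₂} {c₁′ , c₂′}
    (p₁≢c₁ , _ , _ , p₂≢c₂) (p₁≢c₁′ , _ , _ , p₂≢c₂′) adj adj′ c≢c′ = c₁≢c₁′ , c₂≢c₂′
    where
      c₁≢c₁′ : c₁ ≢ c₁′
      c₁≢c₁′ refl = proj₂ proper p₂ c₂ c₂′ p₂≢c₂ p₂≢c₂′ (c≢c′ ∘ cong (c₁ ,_)) (trans (sym adj) adj′)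
      c₂≢c₂′ : c₂ ≢ c₂′
      c₂≢c₂′ refl = proj₂ proper p₁ c₁ c₁′ p₁≢c₁ p₁≢c₁′ c₁≢c₁′ (trans adj (sym adj′))

record SidesApart {n : ℕ} (A B : List (V𝒢 n)) : Set where
  field
    across : ∀ {a b} → a ∈ A → b ∈ B → Disjoint a b
    within-A : ∀ {a a′} → a ∈ A → a′ ∈ A → proj₁ a ≢ proj₂ a′
    within-B : ∀ {b b′} → b ∈ B → b′ ∈ B → proj₁ b ≢ proj₂ b′

module _ {n : ℕ} (part : Fin n → Fin 4) where

  private
    in-distinct-parts : ∀ {x y i j} → part x ≡ i → part y ≡ j → i ≢ j → x ≢ y
    in-distinct-parts x∈i y∈j i≢j refl = i≢j (trans (sym x∈i) y∈j)

  Side₁-Side₂-Disjoint : {a b : V𝒢 n} → Side₁ part a → Side₂ part b → Disjoint a b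
  Side₁-Side₂-Disjoint (a₁∈X₁ , a₂∈X₂) (b₁∈X₃ , b₂∈X₄) =
    in-distinct-parts a₁∈X₁ b₁∈X₃ (λ ()) , in-distinct-parts a₁∈X₁ b₂∈X₄ (λ ()) ,
    in-distinct-parts a₂∈X₂ b₁∈X₃ (λ ()) , in-distinct-parts a₂∈X₂ b₂∈X₄ (λ ())

  Side₁-cross : {a a′ : V𝒢 n} → Side₁ part a → Side₁ part a′ → proj₁ a ≢ proj₂ a′
  Side₁-cross (a₁∈X₁ , _) (_ , a′₂∈X₂) = in-distinct-parts a₁∈X₁ a′₂∈X₂ (λ ())

  Side₂-cross : {b b′ : V𝒢 n} → Side₂ part b → Side₂ part b′ → proj₁ b ≢ proj₂ b′
  Side₂-cross (b₁∈X₃ , _) (_ , b′₂∈X₄) = in-distinct-parts b₁∈X₃ b′₂∈X₄ (λ ())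

  sidesApart : {A B : List (V𝒢 n)} →
    (All (Side₁ part) A × All (Side₂ part) B) ⊎ (All (Side₂ part) A × All (Side₁ part) B) → SidesApart A B
  sidesApart (inj₁ (A₁ , B₂)) = record
    { across = λ a∈ b∈ → Side₁-Side₂-Disjoint (All.lookup A₁ a∈) (All.lookup B₂ b∈)
    ; within-A = λ a∈ a′∈ → Side₁-cross (All.lookup A₁ a∈) (All.lookup A₁ a′∈)
    ; within-B = λ b∈ b′∈ → Side₂-cross (All.lookup B₂ b∈) (All.lookup B₂ b′∈)
    }
  sidesApart (inj₂ (A₂ , B₁)) = record
    { across = λ a∈ b∈ → Disjoint-sym (Side₁-Side₂-Disjoint (All.lookup B₁ b∈) (All.lookup A₂ a∈))
    ; within-A = λ a∈ a′∈ → Side₂-cross (All.lookup A₂ a∈) (All.lookup A₂ a′∈)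
    ; within-B = λ b∈ b′∈ → Side₁-cross (All.lookup B₁ b∈) (All.lookup B₁ b′∈)
    }

-- Counting light pairs

window-true⇒< : ∀ w h → ((1 ≤ᵇ w) ∧ (w <ᵇ h)) ≡ true → w < h
window-true⇒< w h in-window = <ᵇ⇒< w h (Equivalence.from T-≡ (proj₂ (∧≡true⁻ in-window)))

window-false⇒≥ : ∀ w h → 1 ≤ w → ((1 ≤ᵇ w) ∧ (w <ᵇ h)) ≡ false → h ≤ w
window-false⇒≥ (suc w) h _ not-in-window = ≮⇒≥ (λ w<h → subst T not-in-window (<⇒<ᵇ w<h))

module LightPairs {n : ℕ} (t : ℕ) (e0 : V𝒢 n → V𝒢 n → Bool) (B U : List (V𝒢 n)) where

  light : V𝒢 n → V𝒢 n → Bool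
  light u v = isLight t e0 B (u , v)

  light-sym : ∀ u v → light u v ≡ light v u
  light-sym u v = cong (λ w → (1 ≤ᵇ w) ∧ (w <ᵇ 2 * (t C 2))) (countB-cong (λ c → ∧-comm (e0 u c) (e0 v c)) B)

  open IndependentSets light public

  neighbourhood : V𝒢 n → List (V𝒢 n)
  neighbourhood b = filterᵇ (λ u → e0 u b) U

  ∑-neighbourhood≥ : ∀ δ → (∀ {u} → u ∈ U → δ ≤ deg₀ e0 B u) →
                     length U * δ ≤ ∑[ b ← B ] length (neighbourhood b)
  ∑-neighbourhood≥ δ δ≤deg = begin
    length U * δ                              ≡⟨ sym (∑-const δ U) ⟩
    ∑[ _ ← U ] δ                              ≤⟨ ∑-mono U δ≤deg ⟩
    ∑[ u ← U ] deg₀ e0 B u                    ≡⟨ sym (∑-countB-swap e0 U B) ⟩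
    ∑[ b ← B ] countB (λ u → e0 u b) U        ≡⟨ ∑-cong (λ b → sym (length-filterᵇ (λ u → e0 u b) U)) B ⟩
    ∑[ b ← B ] length (neighbourhood b)       ∎
    where open ≤-Reasoning

  ∑-turán : Unique U → (∀ {b} → b ∈ B → α[ neighbourhood b ]< t) →
    ∑[ b ← B ] (length (neighbourhood b) * length (neighbourhood b))
      ≤ 2 * t * (∑[ b ← B ] edges (neighbourhood b) + ∑[ b ← B ] length (neighbourhood b))
  ∑-turán uniq α< = begin
    ∑[ b ← B ] (length (N b) * length (N b))
      ≤⟨ ∑-mono B (λ {b} b∈ → turán light-sym t (N b) (AllPairsₚ.filter⁺ (T? ∘ λ u → e0 u b) uniq) (α< b∈)) ⟩
    ∑[ b ← B ] (2 * t * (edges (N b) + length (N b)))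
      ≡⟨ ∑-*ˡ (2 * t) (λ b → edges (N b) + length (N b)) B ⟩
    2 * t * ∑[ b ← B ] (edges (N b) + length (N b))
      ≡⟨ cong (2 * t *_) (∑-+ (edges ∘ N) (length ∘ N) B) ⟩
    2 * t * (∑[ b ← B ] edges (N b) + ∑[ b ← B ] length (N b)) ∎
    where
      open ≤-Reasoning
      N = neighbourhood

  private
    common : V𝒢 n × V𝒢 n → V𝒢 n → Bool
    common q b = e0 (proj₁ q) b ∧ e0 (proj₂ q) b

    light-pair-multiplicity : ∀ q → countB (λ b → isLight t e0 B q ∧ common q b) B ≤ 2 * (t C 2) * 𝟙 (isLight t e0 B q)
    light-pair-multiplicity q with isLight t e0 B q in light-q
    ... | true = subst (W e0 B (proj₁ q) (proj₂ q) ≤_) (sym (*-identityʳ (2 * (t C 2))))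
                   (<⇒≤ (window-true⇒< (W e0 B (proj₁ q) (proj₂ q)) (2 * (t C 2)) light-q))
    ... | false = subst (_≤ _) (sym (countB-false B)) z≤n

  ∑-edges-neighbourhood : ∑[ b ← B ] edges (neighbourhood b) ≤ 2 * (t C 2) * lightPairs t e0 B U
  ∑-edges-neighbourhood = begin
    ∑[ b ← B ] edges (neighbourhood b)
      ≡⟨ ∑-cong (λ b → trans (countB-pairs-filterᵇ (isLight t e0 B) (λ u → e0 u b) U)
                             (countB-cong (λ q → ∧-comm (common q b) _) (pairs U))) B ⟩
    ∑[ b ← B ] countB (λ q → isLight t e0 B q ∧ common q b) (pairs U)
      ≡⟨ ∑-countB-swap (λ q b → isLight t e0 B q ∧ common q b) (pairs U) B ⟩
    ∑[ q ← pairs U ] countB (λ b → isLight t e0 B q ∧ common q b) B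
      ≤⟨ ∑-mono (pairs U) (λ {q} _ → light-pair-multiplicity q) ⟩
    ∑[ q ← pairs U ] (2 * (t C 2) * 𝟙 (isLight t e0 B q))
      ≡⟨ ∑-*ˡ (2 * (t C 2)) (𝟙 ∘ isLight t e0 B) (pairs U) ⟩
    2 * (t C 2) * ∑[ q ← pairs U ] 𝟙 (isLight t e0 B q)
      ≡⟨ cong (2 * (t C 2) *_) (sym (countB≡∑ (isLight t e0 B) (pairs U))) ⟩
    2 * (t C 2) * lightPairs t e0 B U ∎
    where open ≤-Reasoning

module _ {n : ℕ} {Col : Set} {χ : Fin n → Fin n → Col} (proper : IsProperColouring n χ)
         {A B : List (V𝒢 n)} (apart : SidesApart A B) {e0 : V𝒢 n → V𝒢 n → Bool}
         (e0⊆𝒢 : ∀ a b → e0 a b ≡ true → (a ∈ A) × (b ∈ B) × Adj𝒢 χ a b) where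

  open SidesApart apart

  neighbours-disjoint : ∀ {a c c′} → e0 a c ≡ true → e0 a c′ ≡ true → c ≢ c′ → Disjoint c c′
  neighbours-disjoint {a} {c} {c′} ac ac′ c≢c′
    with e0⊆𝒢 a c ac | e0⊆𝒢 a c′ ac′
  ... | a∈A , c∈B , adj | _ , c′∈B , adj′
    with common-neighbours-apart proper (across a∈A c∈B) (across a∈A c′∈B) adj adj′ c≢c′
  ... | c₁≢c₁′ , c₂≢c₂′ = c₁≢c₁′ , within-B c∈B c′∈B , within-B c′∈B c∈B ∘ sym , c₂≢c₂′

  co-neighbours-disjoint : ∀ {a a′ b} → e0 a b ≡ true → e0 a′ b ≡ true → a ≢ a′ → Disjoint a a′
  co-neighbours-disjoint {a} {a′} {b} ab a′b a≢a′
    with e0⊆𝒢 a b ab | e0⊆𝒢 a′ b a′b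
  ... | a∈A , b∈B , adj | a′∈A , _ , adj′
    with common-neighbours-apart proper (Disjoint-sym (across a∈A b∈B)) (Disjoint-sym (across a′∈A b∈B))
                                 (Adj𝒢-sym proper adj) (Adj𝒢-sym proper adj′) a≢a′
  ... | a₁≢a₁′ , a₂≢a₂′ = a₁≢a₁′ , within-A a∈A a′∈A , within-A a′∈A a∈A ∘ sym , a₂≢a₂′

  α<-neighbourhood : ∀ t U → let open LightPairs t e0 B U in
    Unique B → ¬ HtCopy t e0 → (∀ u → u ∈ U → u ∈ A) → ∀ {b} → b ∈ B → α[ neighbourhood b ]< t
  α<-neighbourhood t U uniq no-Ht U⊆A {b} b∈B f (f∈N , independent) =
    no-Ht (heavy-branches⇒HtCopy t e0 B uniq neighbours-disjoint f br-disj br#B heavy)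
    where
      f∈U : ∀ i → f i ∈ U
      f∈U i = proj₁ (∈-filterᵇ⁻ (λ u → e0 u b) {xs = U} (f∈N i))
      fb : ∀ i → e0 (f i) b ≡ true
      fb i = proj₂ (∈-filterᵇ⁻ (λ u → e0 u b) {xs = U} (f∈N i))
      br-disj : ∀ {i j} → i ≢ j → Disjoint (f i) (f j)
      br-disj {i} {j} i≢j with F.<-cmp i j
      ... | tri< i<j _ _ = co-neighbours-disjoint (fb i) (fb j) (proj₁ (independent i<j))
      ... | tri≈ _ i≡j _ = ⊥-elim (i≢j i≡j)
      ... | tri> _ _ j<i = Disjoint-sym (co-neighbours-disjoint (fb j) (fb i) (proj₁ (independent j<i)))
      br#B : ∀ i {c} → c ∈ B → Disjoint (f i) c
      br#B i = across (U⊆A _ (f∈U i))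
      heavy : ∀ {i j} → i F.< j → 2 * (t C 2) ≤ W e0 B (f i) (f j)
      heavy {i} {j} i<j = window-false⇒≥ (W e0 B (f i) (f j)) (2 * (t C 2))
        (countB-∈ (λ c → e0 (f i) c ∧ e0 (f j) c) b∈B (cong₂ _∧_ (fb i) (fb j)))
        (proj₂ (independent i<j))

x≤y+z⇒4z≤x⇒x≤4y : ∀ x y z → x ≤ y + z → 4 * z ≤ x → x ≤ 4 * y
x≤y+z⇒4z≤x⇒x≤4y x y z x≤y+z 4z≤x = ≤-trans (m≤n*m x 3) (+-cancelʳ-≤ x (3 * x) (4 * y) (begin
  3 * x + x        ≡⟨ +-comm (3 * x) x ⟩
  4 * x            ≤⟨ *-monoʳ-≤ 4 x≤y+z ⟩
  4 * (y + z)      ≡⟨ *-distribˡ-+ 4 y z ⟩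
  4 * y + 4 * z    ≤⟨ +-monoʳ-≤ (4 * y) 4z≤x ⟩
  4 * y + x        ∎))
  where open ≤-Reasoning

S²≤8tmΦ : ∀ t m S Q Φ → S * S ≤ m * Q → Q ≤ 2 * t * (Φ + S) → 8 * t * m ≤ S → S * S ≤ 8 * t * m * Φ
S²≤8tmΦ t m S Q Φ S²≤mQ Q≤ 8tm≤S = subst (S * S ≤_) (quadruple t m Φ)
  (x≤y+z⇒4z≤x⇒x≤4y (S * S) (2 * t * m * Φ) (2 * t * m * S)
    (≤-trans S²≤mQ (≤-trans (*-monoʳ-≤ m Q≤) (≤-reflexive (distribute t m Φ S))))
    (subst (_≤ S * S) (sym (quadruple t m S)) (*-monoˡ-≤ S 8tm≤S)))
  where
    quadruple : ∀ t m x → 4 * (2 * t * m * x) ≡ 8 * t * m * x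
    quadruple = solve-∀
    distribute : ∀ t m Φ S → m * (2 * t * (Φ + S)) ≡ 2 * t * m * Φ + 2 * t * m * S
    distribute = solve-∀

light-pairs-bound : ∀ t m δ N S Q Φ Λ →
  S * S ≤ m * Q → Q ≤ 2 * t * (Φ + S) → N * δ ≤ S → 8 * t * m ≤ N * δ → Φ ≤ 2 * (t C 2) * Λ →
  δ ^ 2 * (N C 2) ≤ 16 * t ^ 3 * m * Λ
light-pairs-bound t m δ N S Q Φ Λ S²≤mQ Q≤ Nδ≤S 8tm≤Nδ Φ≤ = begin
  δ ^ 2 * (N C 2)                  ≤⟨ *-monoʳ-≤ (δ ^ 2) (≤-trans (m≤n*m (N C 2) 2) (2*nC2≤n*n N)) ⟩
  δ ^ 2 * (N * N)                  ≡⟨ regroup δ N ⟩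
  (N * δ) * (N * δ)                ≤⟨ *-mono-≤ Nδ≤S Nδ≤S ⟩
  S * S                            ≤⟨ S²≤8tmΦ t m S Q Φ S²≤mQ Q≤ (≤-trans 8tm≤Nδ Nδ≤S) ⟩
  8 * t * m * Φ                    ≤⟨ *-monoʳ-≤ (8 * t * m) (≤-trans Φ≤ (*-monoˡ-≤ Λ (2*nC2≤n*n t))) ⟩
  8 * t * m * (t * t * Λ)          ≡⟨ collect t m Λ ⟩
  8 * (t ^ 3 * m * Λ)              ≤⟨ *-monoˡ-≤ (t ^ 3 * m * Λ) (m≤m+n 8 8) ⟩
  16 * (t ^ 3 * m * Λ)             ≡⟨ reassociate t m Λ ⟩
  16 * t ^ 3 * m * Λ               ∎
  where
    open ≤-Reasoning
    regroup : ∀ δ N → δ * (δ * 1) * (N * N) ≡ (N * δ) * (N * δ)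
    regroup = solve-∀
    collect : ∀ t m Λ → 8 * t * m * (t * t * Λ) ≡ 8 * (t * (t * (t * 1)) * m * Λ)
    collect = solve-∀
    reassociate : ∀ t m Λ → 16 * (t * (t * (t * 1)) * m * Λ) ≡ 16 * (t * (t * (t * 1))) * m * Λ
    reassociate = solve-∀

lemma2p6 : (t : ℕ) → 3 ≤ t →
    (n : ℕ) (Col : Set) (χ : Fin n → Fin n → Col) → IsProperColouring n χ →
    (part : Fin n → Fin 4) →
    (A B : List (V𝒢 n)) → Unique A → Unique B →
    ((All (Side₁ part) A × All (Side₂ part) B) ⊎ (All (Side₂ part) A × All (Side₁ part) B)) →
    (e0 : V𝒢 n → V𝒢 n → Bool) →
    (∀ a b → e0 a b ≡ true → (a ∈ A) × (b ∈ B) × Adj𝒢 χ a b) →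
    (m δ : ℕ) → length B ≡ m →
    (∀ a → a ∈ A → δ ≤ deg₀ e0 B a) →
    ¬ HtCopy t e0 →
    (U : List (V𝒢 n)) → Unique U → (∀ u → u ∈ U → u ∈ A) →
    8 * t * m ≤ length U * δ → 2 ≤ length U →
    δ ^ 2 * (length U C 2) ≤ 16 * t ^ 3 * m * lightPairs t e0 B U
lemma2p6 t _ n Col χ proper part A B _ uniq-B sides e0 e0⊆𝒢 m δ |B|≡m δ≤deg no-Ht U uniq-U U⊆A 8tm≤|U|δ _ =
  light-pairs-bound t m δ (length U) S Q Φ (lightPairs t e0 B U)
    (subst (λ k → S * S ≤ k * Q) |B|≡m (∑-cauchy-schwarz (length ∘ neighbourhood) B))
    (∑-turán uniq-U (α<-neighbourhood proper (sidesApart part sides) e0⊆𝒢 t U uniq-B no-Ht U⊆A))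
    (∑-neighbourhood≥ δ (λ u∈ → δ≤deg _ (U⊆A _ u∈)))
    8tm≤|U|δ
    ∑-edges-neighbourhood
  where
    open LightPairs t e0 B U
    S = ∑[ b ← B ] length (neighbourhood b)
    Q = ∑[ b ← B ] (length (neighbourhood b) * length (neighbourhood b))
    Φ = ∑[ b ← B ] edges (neighbourhood b)
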